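{- Let $n\in\mathbb{N}$. Every connected component of the quasi-crystal graph $\Gamma_n$ contains a unique highest-weight word.
   Context: $\mathcal{A}_n=\{1<\dots<n\}$. A word $u\in\mathcal{A}_n^*$ has an $i$-inversion if it contains a letter $i+1$ to the left of a letter $i$. Quasi-Kashiwara operators: if $u$ has an $i$-inversion, $e_i(u),f_i(u)$ are undefined; otherwise $e_i(u)$ replaces the leftmost letter $i+1$ of $u$ by $i$ (undefined if none), and $f_i(u)$ replaces the rightmost letter $i$ by $i+1$ (undefined if none). The quasi-crystal graph $\Gamma_n$ has vertex set $\mathcal{A}_n^*$ and an edge $u\to f_i(u)$ labelled $i$ whenever defined ($i=1,\dots,n-1$). A word is highest-weight if no $e_i$ is defined on it. -}

module Defs where

open import Data.Nat using (ℕ; zero; suc; _<_)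
open import Data.Nat.Properties using (<-trans; n<1+n)
open import Data.Fin using (Fin; toℕ; fromℕ<)
open import Data.List using (List; []; _∷_)
open import Data.Bool.ListAction using (any)
open import Data.Bool using (Bool; true; false; if_then_else_; _∨_)
open import Data.Maybe using (Maybe; just; nothing) renaming (map to mapMaybe)
open import Data.Product using (∃; Σ; _,_)
open import Relation.Nullary.Decidable using (⌊_⌋)
open import Relation.Binary.PropositionalEquality using (_≡_)
open import Relation.Binary.Construct.Closure.Symmetric using (SymClosure)
open import Relation.Binary.Construct.Closure.ReflexiveTransitive using (Star)
import Data.Nat as ℕ

-- Alphabet A_n = {1 < ... < n} is represented by Fin n: the letter a ∈ A_n
-- is the element of Fin n with toℕ = a - 1 (order preserved).
Word : ℕ → Set
Word n = List (Fin n)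

-- Operators e_i, f_i for i = 1, ..., n-1 are indexed here by k = i - 1,
-- with the side condition suc k < n (i.e. i + 1 ≤ n).
isI : ∀ {n} → ℕ → Fin n → Bool
isI k x = ⌊ toℕ x ℕ.≟ k ⌋

isI+1 : ∀ {n} → ℕ → Fin n → Bool
isI+1 k x = ⌊ toℕ x ℕ.≟ suc k ⌋

hasInversion : ∀ {n} → ℕ → Word n → Bool
hasInversion k [] = false
hasInversion k (x ∷ u) =
  if isI+1 k x then (any (isI k) u ∨ hasInversion k u)
  else hasInversion k u

letterI : ∀ {n} (k : ℕ) → suc k < n → Fin n
letterI k h = fromℕ< (<-trans (n<1+n k) h)

letterI+1 : ∀ {n} (k : ℕ) → suc k < n → Fin n
letterI+1 k h = fromℕ< h

replaceLeftmost : ∀ {n} (k : ℕ) → suc k < n → Word n → Maybe (Word n)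
replaceLeftmost k h [] = nothing
replaceLeftmost k h (x ∷ u) =
  if isI+1 k x then just (letterI k h ∷ u)
  else mapMaybe (x ∷_) (replaceLeftmost k h u)

replaceRightmost : ∀ {n} (k : ℕ) → suc k < n → Word n → Maybe (Word n)
replaceRightmost k h [] = nothing
replaceRightmost k h (x ∷ u) with replaceRightmost k h u
... | just u' = just (x ∷ u')
... | nothing = if isI k x then just (letterI+1 k h ∷ u) else nothing

e : ∀ {n} (k : ℕ) → suc k < n → Word n → Maybe (Word n)
e k h u = if hasInversion k u then nothing else replaceLeftmost k h u

f : ∀ {n} (k : ℕ) → suc k < n → Word n → Maybe (Word n)
f k h u = if hasInversion k u then nothing else replaceRightmost k h u

Edge : ∀ {n} → Word n → Word n → Set
Edge {n} u v = ∃ λ k → Σ (suc k < n) λ h → f k h u ≡ just v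

SameComponent : ∀ {n} → Word n → Word n → Set
SameComponent = Star (SymClosure Edge)

HighestWeight : ∀ {n} → Word n → Set
HighestWeight {n} u = ∀ (k : ℕ) (h : suc k < n) → e k h u ≡ nothing

-- Applying some e_i lowers the sum of the letters, and e_i(u) = v gives the edge v → u, so
-- iterating the e_i from any word reaches a highest-weight word in its component.
-- For uniqueness, the comparison pattern (which of u_p ≤ u_q hold for p < q) is constant on
-- components: f_i only turns the rightmost i into i + 1, and since u has no i-inversion this
-- letter has no i + 1 before it and no i after it. A highest-weight word w is the least word
-- with its pattern: whenever k + 1 occurs in w, w has a k-inversion, so by induction on k
-- any w′ with the same pattern satisfies w ≤ w′ letterwise at the positions holding k + 1.
-- Two highest-weight words of one component are thus letterwise ≤ each other.
module Submission where

open import Defs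
open import Data.Bool using (Bool; true; false; _∨_)
open import Data.Bool.ListAction using (any)
open import Data.Bool.Properties using (T-≡)
open import Data.Empty using (⊥-elim)
open import Data.Fin as Fin using (Fin; zero; suc; toℕ; cast)
open import Data.Fin.Properties using (toℕ-fromℕ<; toℕ-injective; toℕ<n; toℕ-cast; <-cmp; ≤-antisym)
open import Data.List using (List; []; _∷_; map; length; lookup)
open import Data.List.Properties using (∷-injectiveˡ; ∷-injectiveʳ)
import Data.List.Relation.Binary.Pointwise as Pointwise
open import Data.List.Relation.Unary.Any using (index)
open import Data.List.Relation.Unary.Any.Properties using (any⁻; lookup-index)
open import Data.Maybe using (just; nothing)
open import Data.Nat as ℕ using (ℕ; zero; suc; _≤_; _<_; z≤n; s≤s; s≤s⁻¹)
open import Data.Nat.ListAction using (sum)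
open import Data.Nat.Induction using (<-wellFounded)
open import Data.Nat.Properties
  using (≤-refl; ≤-reflexive; <⇒≤; ≤∧≢⇒<; m≤n⇒m≤1+n; 1+n≢n; <-trans; <⇒≱; +-monoʳ-<; n<1+n; ≰⇒>;
         ≤-irrelevant; anyUpTo?; module ≤-Reasoning)
open import Data.Product using (∃; ∃₂; Σ; _×_; _,_; proj₁; proj₂)
open import Data.Sum using (_⊎_; inj₁; inj₂)
open import Function using (_∘_; _⇔_; mk⇔; Equivalence)
open import Induction.WellFounded using (Acc; acc)
open import Relation.Binary.Definitions using (tri<; tri≈; tri>)
open import Relation.Binary.PropositionalEquality
open import Relation.Binary.Construct.Closure.ReflexiveTransitive as Star using (ε; _◅_)
open import Relation.Binary.Construct.Closure.Symmetric as SymClosure using (bwd)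
open import Relation.Nullary using (Dec; yes; no; ¬_; does; contradiction)
open import Relation.Nullary.Decidable using (⌊_⌋; isYes≗does; dec-true; dec-false; does-⇔; toWitness)
open import Relation.Unary using (Decidable)

private
  variable
    n k : ℕ
    x : Fin n
    u v w w′ : Word n

⌊⌋≡true : ∀ {a} {A : Set a} (a? : Dec A) → A → ⌊ a? ⌋ ≡ true
⌊⌋≡true a? a = trans (isYes≗does a?) (dec-true a? a)

⌊⌋≡false : ∀ {a} {A : Set a} (a? : Dec A) → ¬ A → ⌊ a? ⌋ ≡ false
⌊⌋≡false a? ¬a = trans (isYes≗does a?) (dec-false a? ¬a)

⌊⌋≡true⇒ : ∀ {a} {A : Set a} (a? : Dec A) → ⌊ a? ⌋ ≡ true → A
⌊⌋≡true⇒ (yes a) _ = a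

⌊⌋≡false⇒¬ : ∀ {a} {A : Set a} (a? : Dec A) → ⌊ a? ⌋ ≡ false → ¬ A
⌊⌋≡false⇒¬ (no ¬a) _ = ¬a

does-≡⇒⇔ : ∀ {a b} {A : Set a} {B : Set b} (a? : Dec A) (b? : Dec B) →
           does a? ≡ does b? → A ⇔ B
does-≡⇒⇔ (yes a) (yes b) _ = mk⇔ (λ _ → b) (λ _ → a)
does-≡⇒⇔ (no ¬a) (no ¬b) _ = mk⇔ (⊥-elim ∘ ¬a) (⊥-elim ∘ ¬b)
does-≡⇒⇔ (yes _) (no _) ()
does-≡⇒⇔ (no _) (yes _) ()

∨≡false : ∀ a {b} → a ∨ b ≡ false → a ≡ false × b ≡ false
∨≡false false b≡false = refl , b≡false

m≢1+n⇒[m≤n⇔m≤1+n] : ∀ {m n} → m ≢ suc n → m ≤ n ⇔ m ≤ suc n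
m≢1+n⇒[m≤n⇔m≤1+n] m≢1+n = mk⇔ m≤n⇒m≤1+n (λ m≤1+n → s≤s⁻¹ (≤∧≢⇒< m≤1+n m≢1+n))

n≢m⇒[m≤n⇔1+m≤n] : ∀ {m n} → n ≢ m → m ≤ n ⇔ suc m ≤ n
n≢m⇒[m≤n⇔1+m≤n] n≢m = mk⇔ (λ m≤n → ≤∧≢⇒< m≤n (n≢m ∘ sym)) <⇒≤

toℕ-letterI : (h : suc k < n) → toℕ (letterI k h) ≡ k
toℕ-letterI h = toℕ-fromℕ< _

toℕ-letterI+1 : (h : suc k < n) → toℕ (letterI+1 k h) ≡ suc k
toℕ-letterI+1 h = toℕ-fromℕ< h

isI+1-letterI : (h : suc k < n) → isI+1 k (letterI k h) ≡ false
isI+1-letterI {k} h =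
  ⌊⌋≡false (toℕ (letterI k h) ℕ.≟ suc k) (λ eq → 1+n≢n (trans (sym eq) (toℕ-letterI h)))

noInversion-∷ : hasInversion k (x ∷ u) ≡ false →
                (toℕ x ≡ suc k → any (isI k) u ≡ false) × hasInversion k u ≡ false
noInversion-∷ {k} {x = x} {u} noInv with isI+1 k x in x≟
... | false = (λ x≡ → contradiction x≡ (⌊⌋≡false⇒¬ (toℕ x ℕ.≟ suc k) x≟)) , noInv
... | true = let u∌k , noInv′ = ∨≡false _ noInv in (λ _ → u∌k) , noInv′

replaceRightmost-absent : (h : suc k < n) → any (isI k) u ≡ false → replaceRightmost k h u ≡ nothing
replaceRightmost-absent {u = []} h _ = refl
replaceRightmost-absent {k} {u = x ∷ u} h absent
  with x∉ , u∌k ← ∨≡false (isI k x) absent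
  with replaceRightmost k h u | replaceRightmost-absent {u = u} h u∌k
... | nothing | refl rewrite x∉ = refl

replaceRightmost-head : (h : suc k < n) → toℕ x ≡ k → any (isI k) u ≡ false →
                        replaceRightmost k h (x ∷ u) ≡ just (letterI+1 k h ∷ u)
replaceRightmost-head {k} {x = x} {u} h x≡k u∌k
  with replaceRightmost k h u | replaceRightmost-absent {u = u} h u∌k
... | nothing | refl rewrite ⌊⌋≡true (toℕ x ℕ.≟ k) x≡k = refl

replaceLeftmost-inverse : (h : suc k < n) → hasInversion k u ≡ false → replaceLeftmost k h u ≡ just v →
                          hasInversion k v ≡ false × replaceRightmost k h v ≡ just u
replaceLeftmost-inverse {k} {u = x ∷ u} h noInv rl
  with u∌k , noInv′ ← noInversion-∷ {x = x} {u = u} noInv | isI+1 k x in x≟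
... | true with refl ← rl | x≡k+1 ← ⌊⌋≡true⇒ (toℕ x ℕ.≟ suc k) x≟
  rewrite isI+1-letterI h
  = noInv′ , trans (replaceRightmost-head h (toℕ-letterI h) (u∌k x≡k+1))
                   (cong (λ y → just (y ∷ u)) (toℕ-injective (trans (toℕ-letterI+1 h) (sym x≡k+1))))
... | false with replaceLeftmost k h u in rl′
...   | just v′ with refl ← rl with noInv″ , rr ← replaceLeftmost-inverse {u = u} h noInv′ rl′
  rewrite x≟ | rr = noInv″ , refl

letterSum : Word n → ℕ
letterSum = sum ∘ map toℕ

replaceLeftmost-letterSum : (h : suc k < n) → replaceLeftmost k h u ≡ just v → letterSum v < letterSum u
replaceLeftmost-letterSum {k} {u = x ∷ u} h rl with isI+1 k x in x≟
... | true with refl ← rl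
  rewrite toℕ-letterI h | ⌊⌋≡true⇒ (toℕ x ℕ.≟ suc k) x≟ = ≤-refl
... | false with replaceLeftmost k h u in rl′
...   | just v′ with refl ← rl = +-monoʳ-< (toℕ x) (replaceLeftmost-letterSum {u = u} h rl′)

e≡just⇒replaceLeftmost : (h : suc k < n) → e k h u ≡ just v →
            hasInversion k u ≡ false × replaceLeftmost k h u ≡ just v
e≡just⇒replaceLeftmost {k} {u = u} h eu with hasInversion k u
... | false = refl , eu

e⇒Edge : (h : suc k < n) → e k h u ≡ just v → Edge v u
e⇒Edge {k} {u = u} {v} h eu = k , h , f-v
  where
  f-v : f k h v ≡ just u
  f-v with noInv , rl ← e≡just⇒replaceLeftmost {u = u} h eu
      with noInv′ , rr ← replaceLeftmost-inverse {u = u} h noInv rl rewrite noInv′ = rr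

e-letterSum : (h : suc k < n) → e k h u ≡ just v → letterSum v < letterSum u
e-letterSum {u = u} h eu = replaceLeftmost-letterSum {u = u} h (proj₂ (e≡just⇒replaceLeftmost {u = u} h eu))

Raisable : Word n → ℕ → Set
Raisable {n} u k = Σ (suc k < n) λ h → ∃ λ v → e k h u ≡ just v

raisable? : (u : Word n) → Decidable (Raisable u)
raisable? {n} u k with suc k ℕ.<? n
... | no k+1≮n = no (k+1≮n ∘ proj₁)
... | yes h with e k h u in eu
...   | just v = yes (h , v , eu)
...   | nothing = no λ (h′ , v , eu′) →
  nothing≢just (trans (sym eu) (trans (e-irrelevant h h′) eu′))
  where
  e-irrelevant : (h h′ : suc k < n) → e k h u ≡ e k h′ u
  e-irrelevant h h′ = cong (λ h → e k h u) (≤-irrelevant h h′)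
  nothing≢just : ∀ {v} → nothing ≢ just v
  nothing≢just ()

highestWeight-or-raisable : (u : Word n) → HighestWeight u ⊎ ∃ (Raisable u)
highestWeight-or-raisable {n} u with anyUpTo? (raisable? u) n
... | yes (k , _ , raise) = inj₂ (k , raise)
... | no none = inj₁ highest
  where
  highest : HighestWeight u
  highest k h with e k h u in eu
  ... | nothing = refl
  ... | just v = contradiction (k , <-trans (n<1+n k) h , h , v , eu) none

reachHighestWeight : (u : Word n) → Acc _<_ (letterSum u) →
                     ∃ λ w → SameComponent u w × HighestWeight w
reachHighestWeight u (acc smaller) with highestWeight-or-raisable u
... | inj₁ hw = u , ε , hw
... | inj₂ (k , h , v , eu) =
  let w , v⇝w , hw = reachHighestWeight v (smaller (e-letterSum {u = u} h eu))
  in  w , bwd (e⇒Edge {u = u} h eu) ◅ v⇝w , hw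

_≤ᵇ_ : Fin n → Fin n → Bool
x ≤ᵇ y = does (toℕ x ℕ.≤? toℕ y)

comparisons : Word n → List (List Bool)
comparisons []      = []
comparisons (x ∷ u) = map (x ≤ᵇ_) u ∷ comparisons u

length-comparisons : (w : Word n) → length (comparisons w) ≡ length w
length-comparisons []      = refl
length-comparisons (x ∷ w) = cong suc (length-comparisons w)

map-replaceRightmost : ∀ {B : Set} (g : Fin n → B) (h : suc k < n) →
                       (∀ z → toℕ z ≡ k → g z ≡ g (letterI+1 k h)) →
                       replaceRightmost k h u ≡ just v → map g u ≡ map g v
map-replaceRightmost {k = k} {u = x ∷ u} g h g-stable rr with replaceRightmost k h u in rr′
... | just v′ with refl ← rr = cong (g x ∷_) (map-replaceRightmost {u = u} g h g-stable rr′)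
... | nothing with isI k x in x≟
...   | true with refl ← rr = cong (_∷ map g u) (g-stable x (⌊⌋≡true⇒ (toℕ x ℕ.≟ k) x≟))

map-replaceRightmost-nothing : ∀ {B : Set} (g g′ : Fin n → B) (h : suc k < n) →
                               (∀ z → toℕ z ≢ k → g z ≡ g′ z) →
                               replaceRightmost k h u ≡ nothing → map g u ≡ map g′ u
map-replaceRightmost-nothing {u = []} g g′ h g≗g′ rr = refl
map-replaceRightmost-nothing {k = k} {u = x ∷ u} g g′ h g≗g′ rr with replaceRightmost k h u in rr′
... | nothing with isI k x in x≟
...   | false = cong₂ _∷_ (g≗g′ x (⌊⌋≡false⇒¬ (toℕ x ℕ.≟ k) x≟))
                          (map-replaceRightmost-nothing {u = u} g g′ h g≗g′ rr′)

comparisons-replaceRightmost : (h : suc k < n) → hasInversion k u ≡ false →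
                               replaceRightmost k h u ≡ just v → comparisons u ≡ comparisons v
comparisons-replaceRightmost {k} {u = x ∷ u} h noInv rr
  with u∌k , noInv′ ← noInversion-∷ {x = x} {u = u} noInv | replaceRightmost k h u in rr′
... | just v′ with refl ← rr =
  cong₂ _∷_ (map-replaceRightmost {u = u} (x ≤ᵇ_) h row-stable rr′)
            (comparisons-replaceRightmost {u = u} h noInv′ rr′)
  where
  x≢k+1 : toℕ x ≢ suc k
  x≢k+1 x≡k+1 with () ← trans (sym (replaceRightmost-absent {u = u} h (u∌k x≡k+1))) rr′
  row-stable : ∀ z → toℕ z ≡ k → x ≤ᵇ z ≡ x ≤ᵇ letterI+1 k h
  row-stable z z≡k rewrite z≡k | toℕ-letterI+1 h =
    does-⇔ (m≢1+n⇒[m≤n⇔m≤1+n] x≢k+1) (toℕ x ℕ.≤? k) (toℕ x ℕ.≤? suc k)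
... | nothing with isI k x in x≟
...   | true with refl ← rr =
  cong (_∷ comparisons u)
       (map-replaceRightmost-nothing {u = u} (x ≤ᵇ_) (letterI+1 k h ≤ᵇ_) h row-stable rr′)
  where
  row-stable : ∀ z → toℕ z ≢ k → x ≤ᵇ z ≡ letterI+1 k h ≤ᵇ z
  row-stable z z≢k rewrite ⌊⌋≡true⇒ (toℕ x ℕ.≟ k) x≟ | toℕ-letterI+1 h =
    does-⇔ (n≢m⇒[m≤n⇔1+m≤n] z≢k) (k ℕ.≤? toℕ z) (suc k ℕ.≤? toℕ z)

Edge⇒comparisons : Edge u v → comparisons u ≡ comparisons v
Edge⇒comparisons {u = u} (k , h , fu) with hasInversion k u in noInv
... | false = comparisons-replaceRightmost {u = u} h noInv fu

SameComponent-invariant : ∀ {B : Set} (g : Word n → B) → (∀ {u v} → Edge u v → g u ≡ g v) →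
                          SameComponent u v → g u ≡ g v
SameComponent-invariant g edge-invariant =
  Star.fold (λ u v → g u ≡ g v) (trans ∘ SymClosure.fold sym edge-invariant) refl

SameComponent⇒comparisons : SameComponent u v → comparisons u ≡ comparisons v
SameComponent⇒comparisons = SameComponent-invariant comparisons Edge⇒comparisons

module _ {m : ℕ} where

  SamePattern : (a b : Fin m → ℕ) → Set
  SamePattern a b = ∀ {i j} → i Fin.< j → (a i ≤ a j ⇔ b i ≤ b j)

  EveryValueInverted : (Fin m → ℕ) → Set
  EveryValueInverted a = ∀ {i k} → a i ≡ suc k →
                         ∃₂ λ s t → s Fin.< t × a s ≡ suc k × a t ≡ k

  samePattern-minimal : ∀ {a b} → SamePattern a b → EveryValueInverted a → ∀ i → a i ≤ b i
  samePattern-minimal {a} {b} same inverted i = below (a i) i refl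
    where
    open ≤-Reasoning

    descent : ∀ {i j} → i Fin.< j → a j < a i → b j < b i
    descent i<j aj<ai = ≰⇒> λ bi≤bj → <⇒≱ aj<ai (Equivalence.from (same i<j) bi≤bj)

    below : ∀ v i → a i ≡ v → a i ≤ b i
    below zero    i ai≡0 = subst (_≤ b i) (sym ai≡0) z≤n
    below (suc k) i ai≡1+k
      with s , t , s<t , as≡1+k , at≡k ← inverted ai≡1+k
      with k≤bt ← subst (_≤ b t) at≡k (below k t at≡k) | <-cmp i t
    ... | tri≈ _ refl _ = contradiction (trans (sym ai≡1+k) at≡k) 1+n≢n
    ... | tri< i<t _ _ = begin
      a i        ≡⟨ ai≡1+k ⟩
      suc k      ≤⟨ s≤s k≤bt ⟩
      suc (b t)  ≤⟨ descent i<t (≤-reflexive (trans (cong suc at≡k) (sym ai≡1+k))) ⟩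
      b i        ∎
    ... | tri> _ _ t<i = begin
      a i        ≡⟨ ai≡1+k ⟩
      suc k      ≤⟨ s≤s k≤bt ⟩
      suc (b t)  ≤⟨ descent s<t (≤-reflexive (trans (cong suc at≡k) (sym as≡1+k))) ⟩
      b s        ≤⟨ Equivalence.to (same (<-trans s<t t<i)) (≤-reflexive (trans as≡1+k (sym ai≡1+k))) ⟩
      b i        ∎

comparisons-samePattern : comparisons w ≡ comparisons w′ → .(eq : length w ≡ length w′) →
                          SamePattern (toℕ ∘ lookup w) (toℕ ∘ lookup w′ ∘ cast eq)
comparisons-samePattern {w = x ∷ u} {w′ = y ∷ v} same eq {zero} {suc j} _ =
  does-≡⇒⇔ (toℕ x ℕ.≤? toℕ (lookup u j)) (toℕ y ℕ.≤? toℕ (lookup v (cast (cong ℕ.pred eq) j)))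
           (Pointwise.lookup-cast rows (cong ℕ.pred eq) j)
  where rows = Pointwise.map⁻ (x ≤ᵇ_) (y ≤ᵇ_) (Pointwise.≡⇒Pointwise-≡ (∷-injectiveˡ same))
comparisons-samePattern {w = x ∷ u} {w′ = y ∷ v} same eq {suc i} {suc j} (s≤s i<j) =
  comparisons-samePattern {w = u} (∷-injectiveʳ same) (cong ℕ.pred eq) i<j

replaceLeftmost-defined : (h : suc k < n) (i : Fin (length w)) → toℕ (lookup w i) ≡ suc k →
                          ∃ λ v → replaceLeftmost k h w ≡ just v
replaceLeftmost-defined {k} {w = x ∷ w} h zero x≡k+1
  rewrite ⌊⌋≡true (toℕ x ℕ.≟ suc k) x≡k+1 = _ , refl
replaceLeftmost-defined {k} {w = x ∷ w} h (suc i) wi≡k+1 with isI+1 k x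
... | true = _ , refl
... | false with v , rl ← replaceLeftmost-defined {w = w} h i wi≡k+1 rewrite rl = _ , refl

Inversion : ℕ → Word n → Set
Inversion k w = ∃₂ λ s t → s Fin.< t × toℕ (lookup w s) ≡ suc k × toℕ (lookup w t) ≡ k

inversion-∷ : Inversion k w → Inversion k (x ∷ w)
inversion-∷ (s , t , s<t , ws≡1+k , wt≡k) = suc s , suc t , s≤s s<t , ws≡1+k , wt≡k

hasInversion⇒Inversion : hasInversion k w ≡ true → Inversion k w
hasInversion⇒Inversion {k} {w = x ∷ w} inv with isI+1 k x in x≟ | any (isI k) w in w∋k
... | true  | true  = zero , suc (index k∈w) , s≤s z≤n , ⌊⌋≡true⇒ (toℕ x ℕ.≟ suc k) x≟ ,
                      toWitness (lookup-index k∈w)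
  where k∈w = any⁻ (isI k) w (Equivalence.from T-≡ w∋k)
... | true  | false = inversion-∷ (hasInversion⇒Inversion {w = w} inv)
... | false | _     = inversion-∷ (hasInversion⇒Inversion {w = w} inv)

highestWeight-everyValueInverted : HighestWeight w → EveryValueInverted (toℕ ∘ lookup w)
highestWeight-everyValueInverted {n} {w} hw {i} {k} wi≡k+1 = hasInversion⇒Inversion {w = w} inv
  where
  h : suc k < n
  h = subst (_< n) wi≡k+1 (toℕ<n (lookup w i))
  inv : hasInversion k w ≡ true
  inv with hasInversion k w | hw k h
  ... | true  | _  = refl
  ... | false | e≡nothing with v , rl ← replaceLeftmost-defined {w = w} h i wi≡k+1
                    with () ← trans (sym e≡nothing) rl

highestWeight-minimal : HighestWeight w → comparisons w ≡ comparisons w′ →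
                        Pointwise.Pointwise Fin._≤_ w w′
highestWeight-minimal {w = w} {w′ = w′} hw same = Pointwise.lookup⁻ eq below
  where
  eq : length w ≡ length w′
  eq = trans (sym (length-comparisons w)) (trans (cong length same) (length-comparisons w′))
  below : ∀ {i j} → toℕ i ≡ toℕ j → lookup w i Fin.≤ lookup w′ j
  below {i} i≡j =
    subst (λ j → lookup w i Fin.≤ lookup w′ j) (toℕ-injective (trans (toℕ-cast eq i) i≡j))
          (samePattern-minimal (comparisons-samePattern same eq)
                               (highestWeight-everyValueInverted {w = w} hw) i)

highestWeight-unique : HighestWeight w → HighestWeight w′ → comparisons w ≡ comparisons w′ → w ≡ w′
highestWeight-unique hw hw′ same = Pointwise.Pointwise-≡⇒≡ (Pointwise.antisymmetric ≤-antisym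
  (highestWeight-minimal hw same) (highestWeight-minimal hw′ (sym same)))

proposition6p13 : (n : ℕ) (u : Word n) →
    ∃ λ w → SameComponent u w × HighestWeight w ×
      (∀ w′ → SameComponent u w′ → HighestWeight w′ → w′ ≡ w)
proposition6p13 n u with w , u⇝w , hw ← reachHighestWeight u (<-wellFounded (letterSum u)) =
  w , u⇝w , hw , λ w′ u⇝w′ hw′ →
    highestWeight-unique hw′ hw
      (trans (sym (SameComponent⇒comparisons u⇝w′)) (SameComponent⇒comparisons u⇝w))
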